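{- Let $k \geq 3$ be fixed and let $D$ be a digraph that does not contain any digraph in $\mathcal{C}_k \cup \mathcal{C}_k'$ as a subdigraph. Then the digraph $D'$ resulting from cloning a vertex $v \in V(D)$ does not contain any digraph in $\mathcal{C}_k \cup \mathcal{C}_k'$ as a subdigraph either.
   Context: Digraphs have no loops and no parallel arcs (anti-parallel arcs allowed); subdigraphs need not be induced. A digraph $D'$ is obtained from $D$ by cloning $v\in V(D)$ if $D'$ arises from $D$ by adding a new vertex $v'$ with $N^-(v') := N^-(v)$ and $N^+(v') := N^+(v)$ (in- and out-neighbourhoods). $\mathcal{C}_k$ is the family of all directed cycles of length at most $k$, and $\mathcal{C}_k'$ is the family of all orientations of cycles of length at most $k$ consisting of exactly two blocks, one of which has length one. A block of an orientation of a cycle is a maximal connected subdigraph containing neither $x\rightarrow y\leftarrow z$ nor $x\leftarrow y\rightarrow z$ as a subdigraph; its length is its number of arcs. -}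

module Defs where

open import Data.Nat using (ℕ; zero; suc; _+_; _≤_)
open import Data.Nat.DivMod using (_%_; m%n<n)
open import Data.Fin using (Fin; zero; suc; toℕ; fromℕ<)
open import Data.Bool using (Bool; true; false)
open import Data.Product using (Σ; ∃; _×_)
open import Data.Sum using (_⊎_)
open import Relation.Binary.PropositionalEquality using (_≡_; _≢_)
open import Relation.Nullary using (¬_)
open import Function.Definitions using (Injective)

-- An arc relation on the vertex set Fin n.  Parallel arcs cannot occur
-- (an arc is a proposition x → y); anti-parallel arcs are allowed.
ArcRel : ℕ → Set₁
ArcRel n = Fin n → Fin n → Set

record Digraph (n : ℕ) : Set₁ where
  field
    arc      : ArcRel n
    loopless : ∀ v → ¬ arc v v
open Digraph public

Contains : ∀ {n h} → ArcRel n → ArcRel h → Set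
Contains {n} {h} G H =
  Σ (Fin h → Fin n) λ f → Injective _≡_ _≡_ f × (∀ x y → H x y → G (f x) (f y))

next : ∀ {m} → Fin (suc m) → Fin (suc m)
next {m} i = fromℕ< (m%n<n (suc (toℕ i)) (suc m))

prev : ∀ {m} → Fin (suc m) → Fin (suc m)
prev {m} i = fromℕ< (m%n<n (toℕ i + m) (suc m))

dicycle : ∀ m → ArcRel (suc m)
dicycle m x y = y ≡ next x

orientation : ∀ {m} → (Fin (suc m) → Bool) → ArcRel (suc m)
orientation {m} d x y =
  Σ (Fin (suc m)) λ i →
    (d i ≡ true × x ≡ i × y ≡ next i) ⊎ (d i ≡ false × x ≡ next i × y ≡ i)

-- The blocks of the orientation are the maximal directed paths; consecutive
-- edges i, i+1 lie in different blocks exactly when d i ≢ d (next i).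
-- "Exactly two blocks, one of which has length one": there is an edge j
-- which is a block by itself (direction changes on both sides of it) and
-- these are the only two direction changes around the cycle.
TwoBlocksOneOfLengthOne : ∀ {m} → (Fin (suc m) → Bool) → Set
TwoBlocksOneOfLengthOne {m} d =
  Σ (Fin (suc m)) λ j →
    d (prev j) ≢ d j × d j ≢ d (next j) ×
    (∀ i → d i ≢ d (next i) → i ≡ prev j ⊎ i ≡ j)

-- G contains a member of 𝒞_k (directed cycle of length 2..k; the lower
-- bound 2 is forced since digraphs are loopless).
ContainsC : ℕ → ∀ {n} → ArcRel n → Set
ContainsC k G = Σ ℕ λ m → 2 ≤ suc m × suc m ≤ k × Contains G (dicycle m)

-- G contains a member of 𝒞'_k (orientation of a cycle of length ≤ k with
-- exactly two blocks, one of length one; cycles of simple graphs have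
-- length ≥ 3).
ContainsC' : ℕ → ∀ {n} → ArcRel n → Set
ContainsC' k G =
  Σ ℕ λ m → 3 ≤ suc m × suc m ≤ k ×
    Σ (Fin (suc m) → Bool) λ d →
      TwoBlocksOneOfLengthOne d × Contains G (orientation d)

ContainsForbidden : ℕ → ∀ {n} → ArcRel n → Set
ContainsForbidden k G = ContainsC k G ⊎ ContainsC' k G

-- Cloning v: the new vertex is zero, old vertex i becomes suc i.
-- Each vertex of D' is sent to the vertex of D it copies.
cloneMap : ∀ {n} → Fin n → Fin (suc n) → Fin n
cloneMap v zero    = v
cloneMap v (suc i) = i

clone : ∀ {n} → Digraph n → Fin n → Digraph (suc n)
clone D v = record
  { arc      = λ x y → arc D (cloneMap v x) (cloneMap v y)
  ; loopless = λ x → loopless D (cloneMap v x)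
  }

{-# OPTIONS --safe #-}
module Submission where

-- An embedding of a forbidden digraph H into the clone either misses one of the
-- two copies of v, and then composing it with the projection onto D embeds H
-- into D, or it hits both.  Every member of 𝒞_k ∪ 𝒞'_k has a directed
-- Hamiltonian path: the directed cycle minus one arc, resp. the long block
-- traversed in its direction.  The segment of that path between the two copies
-- projects to a closed walk in D through v without further repetitions, i.e. to
-- a directed cycle of length at most k (length one is excluded: D has no loops).

open import Defs
open import Data.Bool using (Bool; true; false)
import Data.Bool.Properties as Bool
open import Data.Empty using (⊥-elim)
open import Data.Fin using (Fin; zero; suc; toℕ)
open import Data.Fin.Properties using (toℕ-injective; toℕ-fromℕ<; toℕ<n; toℕ≤pred[n]; any?)
  renaming (_≟_ to _≟ᶠ_)
open import Data.Nat using (ℕ; zero; suc; _+_; _∸_; _≤_; _<_; z≤n; s≤s; z<s; NonZero)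
open import Data.Nat.Divisibility using (∣-refl)
open import Data.Nat.DivMod
  using (_%_; _mod_; m%n<n; m<n⇒m%n≡m; n%n≡0; %-distribˡ-+; m%n%n≡m%n; [m+n]%n≡m%n; %-remove-+ˡ)
open import Data.Nat.Properties
open import Data.Product using (∃₂; _×_; _,_; proj₁)
open import Data.Sum using (_⊎_; inj₁; inj₂)
open import Function using (_∘_; flip)
open import Function.Definitions using (Injective)
open import Relation.Binary.Definitions using (tri<; tri≈; tri>)
open import Relation.Binary.PropositionalEquality
open import Relation.Nullary using (¬_; yes; no)

private
  variable
    n h l : ℕ

record Path (G : ArcRel n) (l : ℕ) : Set where
  field
    at           : ℕ → Fin n
    step         : ∀ {t} → t < l → G (at t) (at (suc t))
    at-injective : ∀ {i j} → i ≤ l → j ≤ l → at i ≡ at j → i ≡ j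

open Path

record HamiltonianPath (G : ArcRel n) (l : ℕ) : Set where
  field
    path        : Path G l
    position    : Fin n → ℕ
    position≤   : ∀ x → position x ≤ l
    at-position : ∀ x → at path (position x) ≡ x

open HamiltonianPath

Path-map : {G : ArcRel n} {H : ArcRel h} → Contains G H → Path H l → Path G l
Path-map (f , f-injective , f-arc) P = record
  { at           = f ∘ at P
  ; step         = f-arc _ _ ∘ step P
  ; at-injective = λ i≤l j≤l → at-injective P i≤l j≤l ∘ f-injective
  }

Path-drop : {G : ArcRel n} (p : ℕ) {l′ : ℕ} → p + l′ ≤ l → Path G l → Path G l′
Path-drop {l = l} {G = G} p {l′} p+l′≤l P = record
  { at           = at P ∘ (p +_)
  ; step         = λ {t} t<l′ →
      subst (G (at P (p + t)) ∘ at P) (sym (+-suc p t))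
            (step P (<-≤-trans (+-monoʳ-< p t<l′) p+l′≤l))
  ; at-injective = λ {i} {j} i≤l′ j≤l′ →
      +-cancelˡ-≡ p i j ∘ at-injective P (bound i≤l′) (bound j≤l′)
  }
  where
    bound : ∀ {i} → i ≤ l′ → p + i ≤ l
    bound i≤l′ = ≤-trans (+-monoʳ-≤ p i≤l′) p+l′≤l

Path-reverse : {G : ArcRel n} → Path (flip G) l → Path G l
Path-reverse {l = l} {G = G} P = record
  { at           = at P ∘ (l ∸_)
  ; step         = λ {t} t<l →
      subst (flip G (at P (l ∸ suc t)) ∘ at P) (sym (+-∸-assoc 1 t<l))
            (step P (∸-monoʳ-< z<s t<l))
  ; at-injective = λ {i} {j} i≤l j≤l →
      ∸-cancelˡ-≡ i≤l j≤l ∘ at-injective P (m∸n≤m l i) (m∸n≤m l j)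
  }

HamiltonianPath-reverse : {G : ArcRel n} → HamiltonianPath (flip G) l → HamiltonianPath G l
HamiltonianPath-reverse {l = l} P = record
  { path        = Path-reverse (path P)
  ; position    = (l ∸_) ∘ position P
  ; position≤   = λ x → m∸n≤m l (position P x)
  ; at-position = λ x →
      trans (cong (at (path P)) (m∸[m∸n]≡n (position≤ P x))) (at-position P x)
  }

HamiltonianPath-transfer : {G G′ : ArcRel n} (P : HamiltonianPath G l) →
  (∀ {t} → t < l → G′ (at (path P) t) (at (path P) (suc t))) → HamiltonianPath G′ l
HamiltonianPath-transfer P step′ = record
  { path        = record { at = at (path P) ; step = step′ ; at-injective = at-injective (path P) }
  ; position    = position P
  ; position≤   = position≤ P
  ; at-position = at-position P
  }

toℕ-next : ∀ {m} (x : Fin (suc m)) → toℕ (next x) ≡ suc (toℕ x) % suc m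
toℕ-next x = toℕ-fromℕ< _

Path+arc⇒dicycle : {G : ArcRel n} (P : Path G l) → G (at P l) (at P 0) → Contains G (dicycle l)
Path+arc⇒dicycle {l = l} {G = G} P closing =
  at P ∘ toℕ , toℕ-injective ∘ at-injective P (toℕ≤pred[n] _) (toℕ≤pred[n] _) , arcs
  where
    arcs : ∀ x y → dicycle l x y → G (at P (toℕ x)) (at P (toℕ y))
    arcs x _ refl with m≤n⇒m<n∨m≡n (toℕ≤pred[n] x)
    ... | inj₁ x<l = subst (G (at P (toℕ x)) ∘ at P)
                           (sym (trans (toℕ-next x) (m<n⇒m%n≡m (s≤s x<l))))
                           (step P x<l)
    ... | inj₂ x≡l = subst₂ (λ i j → G (at P i) (at P j))
                            (sym x≡l)
                            (sym (trans (toℕ-next x)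
                                        (trans (cong (λ i → suc i % suc l) x≡l) (n%n≡0 (suc l)))))
                            closing

ContainsC-mono : ∀ {k k′} {G : ArcRel n} → k ≤ k′ → ContainsC k G → ContainsC k′ G
ContainsC-mono k≤k′ (m , 2≤ , m<k , e) = m , 2≤ , ≤-trans m<k k≤k′ , e

[m+n%d]%d≡[m+n]%d : ∀ m n d .{{_ : NonZero d}} → (m + n % d) % d ≡ (m + n) % d
[m+n%d]%d≡[m+n]%d m n d = begin
  (m + n % d) % d         ≡⟨ %-distribˡ-+ m (n % d) d ⟩
  (m % d + n % d % d) % d ≡⟨ cong (λ r → (m % d + r) % d) (m%n%n≡m%n n d) ⟩
  (m % d + n % d) % d     ≡⟨ %-distribˡ-+ m n d ⟨
  (m + n) % d             ∎
  where open ≡-Reasoning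

module _ {m : ℕ} where

  toℕ-mod : ∀ x → toℕ (x mod suc m) ≡ x % suc m
  toℕ-mod x = toℕ-fromℕ< _

  mod-cong : ∀ x y → x % suc m ≡ y % suc m → x mod suc m ≡ y mod suc m
  mod-cong x y e = toℕ-injective (trans (toℕ-mod x) (trans e (sym (toℕ-mod y))))

  mod-toℕ : (x : Fin (suc m)) → toℕ x mod suc m ≡ x
  mod-toℕ x = toℕ-injective (trans (toℕ-mod (toℕ x)) (m<n⇒m%n≡m (toℕ<n x)))

  next-mod : ∀ x → next (x mod suc m) ≡ suc x mod suc m
  next-mod x = mod-cong (suc (toℕ (x mod suc m))) (suc x)
    (trans (cong (λ r → suc r % suc m) (toℕ-mod x)) ([m+n%d]%d≡[m+n]%d 1 x (suc m)))

  next-prev : (x : Fin (suc m)) → next (prev x) ≡ x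
  next-prev x = begin
    next ((toℕ x + m) mod suc m) ≡⟨ next-mod (toℕ x + m) ⟩
    suc (toℕ x + m) mod suc m    ≡⟨ mod-cong (suc (toℕ x + m)) (toℕ x)
                                      (trans (cong (_% suc m) (sym (+-suc (toℕ x) m))) ([m+n]%n≡m%n (toℕ x) (suc m))) ⟩
    toℕ x mod suc m              ≡⟨ mod-toℕ x ⟩
    x                            ∎
    where open ≡-Reasoning

  around : Fin (suc m) → ℕ → Fin (suc m)
  around s t = (toℕ s + t) mod suc m

  offset : Fin (suc m) → Fin (suc m) → ℕ
  offset s x = (suc m ∸ toℕ s + toℕ x) % suc m

  around-suc : ∀ s t → around s (suc t) ≡ next (around s t)
  around-suc s t = trans (cong (_mod suc m) (+-suc (toℕ s) t)) (sym (next-mod (toℕ s + t)))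

  around-zero : ∀ s → around s 0 ≡ s
  around-zero s = trans (cong (_mod suc m) (+-identityʳ (toℕ s))) (mod-toℕ s)

  offset-around : ∀ s {t} → t ≤ m → offset s (around s t) ≡ t
  offset-around s {t} t≤m = begin
    (suc m ∸ toℕ s + toℕ (around s t)) % suc m    ≡⟨ cong (λ r → (suc m ∸ toℕ s + r) % suc m) (toℕ-mod (toℕ s + t)) ⟩
    (suc m ∸ toℕ s + (toℕ s + t) % suc m) % suc m ≡⟨ [m+n%d]%d≡[m+n]%d (suc m ∸ toℕ s) (toℕ s + t) (suc m) ⟩
    (suc m ∸ toℕ s + (toℕ s + t)) % suc m         ≡⟨ cong (_% suc m) (sym (+-assoc (suc m ∸ toℕ s) (toℕ s) t)) ⟩
    (suc m ∸ toℕ s + toℕ s + t) % suc m           ≡⟨ cong (λ r → (r + t) % suc m) (m∸n+n≡m (<⇒≤ (toℕ<n s))) ⟩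
    (suc m + t) % suc m                           ≡⟨ %-remove-+ˡ t ∣-refl ⟩
    t % suc m                                     ≡⟨ m<n⇒m%n≡m (s≤s t≤m) ⟩
    t                                             ∎
    where open ≡-Reasoning

  around-offset : ∀ s x → around s (offset s x) ≡ x
  around-offset s x = trans (mod-cong (toℕ s + offset s x) (toℕ x) (begin
    (toℕ s + (suc m ∸ toℕ s + toℕ x) % suc m) % suc m ≡⟨ [m+n%d]%d≡[m+n]%d (toℕ s) _ (suc m) ⟩
    (toℕ s + (suc m ∸ toℕ s + toℕ x)) % suc m         ≡⟨ cong (_% suc m) (sym (+-assoc (toℕ s) _ (toℕ x))) ⟩
    (toℕ s + (suc m ∸ toℕ s) + toℕ x) % suc m         ≡⟨ cong (λ r → (r + toℕ x) % suc m) (m+[n∸m]≡n (<⇒≤ (toℕ<n s))) ⟩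
    (suc m + toℕ x) % suc m                           ≡⟨ %-remove-+ˡ (toℕ x) ∣-refl ⟩
    toℕ x % suc m                                     ∎)) (mod-toℕ x)
    where open ≡-Reasoning

  around-injective : ∀ s {i j} → i ≤ m → j ≤ m → around s i ≡ around s j → i ≡ j
  around-injective s {i} {j} i≤m j≤m e =
    trans (sym (offset-around s i≤m)) (trans (cong (offset s) e) (offset-around s j≤m))

  around-returns : ∀ s {t} → t ≤ m → around s t ≡ s → t ≡ 0
  around-returns s t≤m e = around-injective s t≤m z≤n (trans e (sym (around-zero s)))

  around-hamiltonian : Fin (suc m) → HamiltonianPath (dicycle m) m
  around-hamiltonian s = record
    { path        = record
        { at           = around s
        ; step         = λ {t} _ → around-suc s t
        ; at-injective = around-injective s
        }
    ; position    = offset s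
    ; position≤   = λ x → ≤-pred (m%n<n (suc m ∸ toℕ s + toℕ x) (suc m))
    ; at-position = around-offset s
    }

module _ {m : ℕ} {d : Fin (suc m) → Bool} {j : Fin (suc m)}
         (changes : ∀ i → d i ≢ d (next i) → i ≡ prev j ⊎ i ≡ j) where

  -- Edge i joins i and next i, so the long block consists of the edges
  -- around (next j) t with t < m.
  long-block-direction : ∀ {t} → t < m → d (around (next j) t) ≡ d (next j)
  long-block-direction {zero}  _     = cong d (around-zero (next j))
  long-block-direction {suc t} 1+t<m with d (around (next j) t) Bool.≟ d (next (around (next j) t))
  ... | yes same =
    trans (cong d (around-suc (next j) t)) (trans (sym same) (long-block-direction (<⇒≤ 1+t<m)))
  ... | no change with changes _ change
  ...   | inj₁ at-prev = ⊥-elim (1+n≢0 (around-returns (next j) 1+t<m (begin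
            around (next j) (suc (suc t))   ≡⟨ around-suc (next j) (suc t) ⟩
            next (around (next j) (suc t))  ≡⟨ cong next (around-suc (next j) t) ⟩
            next (next (around (next j) t)) ≡⟨ cong (next ∘ next) at-prev ⟩
            next (next (prev j))            ≡⟨ cong next (next-prev j) ⟩
            next j                          ∎)))
    where open ≡-Reasoning
  ...   | inj₂ at-j = ⊥-elim (1+n≢0 (around-returns (next j) (<⇒≤ 1+t<m)
                                       (trans (around-suc (next j) t) (cong next at-j))))

  orientation-hamiltonian : HamiltonianPath (orientation d) m
  orientation-hamiltonian with d (next j) in direction
  ... | true  = HamiltonianPath-transfer (around-hamiltonian (next j)) λ t<m →
                  _ , inj₁ (trans (long-block-direction t<m) direction , refl , around-suc (next j) _)
  ... | false = HamiltonianPath-reverse (HamiltonianPath-transfer (around-hamiltonian (next j)) λ t<m →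
                  _ , inj₂ (trans (long-block-direction t<m) direction , around-suc (next j) _ , refl))

module _ (D : Digraph n) (v : Fin n) where

  Copies : Fin (suc n) → Fin (suc n) → Set
  Copies x y = (x ≡ zero × y ≡ suc v) ⊎ (x ≡ suc v × y ≡ zero)

  Copies-sym : ∀ {x y} → Copies x y → Copies y x
  Copies-sym (inj₁ (x≡0 , y≡v)) = inj₂ (y≡v , x≡0)
  Copies-sym (inj₂ (x≡v , y≡0)) = inj₁ (y≡0 , x≡v)

  Copies-irrefl : ∀ {x} → ¬ Copies x x
  Copies-irrefl (inj₁ (refl , ()))
  Copies-irrefl (inj₂ (refl , ()))

  Copies-covers : ∀ {x y z w} → Copies x y → Copies z w → x ≡ w ⊎ y ≡ w
  Copies-covers (inj₁ (refl , refl)) (inj₁ (_ , refl)) = inj₂ refl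
  Copies-covers (inj₁ (refl , refl)) (inj₂ (_ , refl)) = inj₁ refl
  Copies-covers (inj₂ (refl , refl)) (inj₁ (_ , refl)) = inj₁ refl
  Copies-covers (inj₂ (refl , refl)) (inj₂ (_ , refl)) = inj₂ refl

  Copies⇒cloneMap-≡ : ∀ {x y} → Copies x y → cloneMap v x ≡ cloneMap v y
  Copies⇒cloneMap-≡ (inj₁ (refl , refl)) = refl
  Copies⇒cloneMap-≡ (inj₂ (refl , refl)) = refl

  cloneMap-≡⇒≡⊎Copies : ∀ x y → cloneMap v x ≡ cloneMap v y → x ≡ y ⊎ Copies x y
  cloneMap-≡⇒≡⊎Copies zero    zero    _ = inj₁ refl
  cloneMap-≡⇒≡⊎Copies zero    (suc y) e = inj₂ (inj₁ (refl , cong suc (sym e)))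
  cloneMap-≡⇒≡⊎Copies (suc x) zero    e = inj₂ (inj₂ (cong suc e , refl))
  cloneMap-≡⇒≡⊎Copies (suc x) (suc y) e = inj₁ (cong suc e)

  copies-path⇒ContainsC : (P : Path (arc (clone D v)) l) → Copies (at P 0) (at P l) → ContainsC l (arc D)
  copies-path⇒ContainsC {zero} P c = ⊥-elim (Copies-irrefl c)
  copies-path⇒ContainsC {suc zero} P c =
    ⊥-elim (loopless D _ (subst (arc D _) (sym (Copies⇒cloneMap-≡ c)) (step P z<s)))
  copies-path⇒ContainsC {suc (suc l)} P c =
    suc l , s≤s (s≤s z≤n) , ≤-refl , Path+arc⇒dicycle projected closing
    where
      projected : Path (arc D) (suc l)
      projected = record
        { at           = cloneMap v ∘ at P
        ; step         = step P ∘ m<n⇒m<1+n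
        ; at-injective = injective
        }
        where
          injective : ∀ {i j} → i ≤ suc l → j ≤ suc l →
                      cloneMap v (at P i) ≡ cloneMap v (at P j) → i ≡ j
          injective i≤ j≤ e with cloneMap-≡⇒≡⊎Copies (at P _) (at P _) e
          ... | inj₁ same = at-injective P (m≤n⇒m≤1+n i≤) (m≤n⇒m≤1+n j≤) same
          ... | inj₂ cij with Copies-covers cij c
          ...   | inj₁ i-last = ⊥-elim (<⇒≢ (s≤s i≤) (at-injective P (m≤n⇒m≤1+n i≤) ≤-refl i-last))
          ...   | inj₂ j-last = ⊥-elim (<⇒≢ (s≤s j≤) (at-injective P (m≤n⇒m≤1+n j≤) ≤-refl j-last))
      closing : arc D (cloneMap v (at P (suc l))) (cloneMap v (at P 0))
      closing = subst (arc D _) (sym (Copies⇒cloneMap-≡ c)) (step P ≤-refl)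

  ordered-copies-on-path⇒ContainsC : (P : Path (arc (clone D v)) l) → ∀ {i j} → i < j → j ≤ l →
                                     Copies (at P i) (at P j) → ContainsC l (arc D)
  ordered-copies-on-path⇒ContainsC P {i} {j} i<j j≤l c =
    ContainsC-mono {G = arc D} (≤-trans (m∸n≤m j i) j≤l)
      (copies-path⇒ContainsC (Path-drop i (subst (_≤ _) (sym i+[j∸i]≡j) j≤l) P)
        (subst₂ Copies (cong (at P) (sym (+-identityʳ i))) (cong (at P) (sym i+[j∸i]≡j)) c))
    where
      i+[j∸i]≡j : i + (j ∸ i) ≡ j
      i+[j∸i]≡j = m+[n∸m]≡n (<⇒≤ i<j)

  copies-on-path⇒ContainsC : (P : Path (arc (clone D v)) l) → ∀ {i j} → i ≤ l → j ≤ l →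
                             Copies (at P i) (at P j) → ContainsC l (arc D)
  copies-on-path⇒ContainsC P {i} {j} i≤l j≤l c with <-cmp i j
  ... | tri< i<j _ _  = ordered-copies-on-path⇒ContainsC P i<j j≤l c
  ... | tri≈ _ refl _ = ⊥-elim (Copies-irrefl c)
  ... | tri> _ _ j<i  = ordered-copies-on-path⇒ContainsC P j<i i≤l (Copies-sym c)

  hamiltonian-copies⇒ContainsC : {H : ArcRel h} → HamiltonianPath H l →
                                 (e : Contains (arc (clone D v)) H) → ∀ {a b} →
                                 Copies (proj₁ e a) (proj₁ e b) → ContainsC l (arc D)
  hamiltonian-copies⇒ContainsC P e {a} {b} c =
    copies-on-path⇒ContainsC (Path-map {G = arc (clone D v)} e (path P)) (position≤ P a) (position≤ P b)
      (subst₂ (λ x y → Copies (proj₁ e x) (proj₁ e y)) (sym (at-position P a)) (sym (at-position P b)) c)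

  Contains-cloneMap : {H : ArcRel h} (f : Fin h → Fin (suc n)) → Injective _≡_ _≡_ f →
               (∀ x y → H x y → arc (clone D v) (f x) (f y)) →
               (∀ {x y} → ¬ Copies (f x) (f y)) → Contains (arc D) H
  Contains-cloneMap f f-injective f-arc separated = cloneMap v ∘ f , injective , f-arc
    where
      injective : Injective _≡_ _≡_ (cloneMap v ∘ f)
      injective {x} {y} e with cloneMap-≡⇒≡⊎Copies (f x) (f y) e
      ... | inj₁ same = f-injective same
      ... | inj₂ copies = ⊥-elim (separated copies)

  unclone : {H : ArcRel h} (e : Contains (arc (clone D v)) H) →
            Contains (arc D) H ⊎ ∃₂ (λ a b → Copies (proj₁ e a) (proj₁ e b))
  unclone (f , f-injective , f-arc) with any? (λ a → f a ≟ᶠ zero) | any? (λ b → f b ≟ᶠ suc v)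
  ... | yes (a , fa≡0) | yes (b , fb≡v) = inj₂ (a , b , inj₁ (fa≡0 , fb≡v))
  ... | no ∄zero | _ = inj₁ (Contains-cloneMap f f-injective f-arc λ
          { (inj₁ (fx≡0 , _)) → ∄zero (_ , fx≡0) ; (inj₂ (_ , fy≡0)) → ∄zero (_ , fy≡0) })
  ... | yes _ | no ∄copy = inj₁ (Contains-cloneMap f f-injective f-arc λ
          { (inj₁ (_ , fy≡v)) → ∄copy (_ , fy≡v) ; (inj₂ (fx≡v , _)) → ∄copy (_ , fx≡v) })

  Contains-unclone : ∀ {k} {H : ArcRel h} → HamiltonianPath H l → l ≤ k → ¬ ContainsC k (arc D) →
                     Contains (arc (clone D v)) H → Contains (arc D) H
  Contains-unclone P l≤k no-cycle e with unclone e
  ... | inj₁ e′               = e′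
  ... | inj₂ (_ , _ , copies) =
    ⊥-elim (no-cycle (ContainsC-mono {G = arc D} l≤k (hamiltonian-copies⇒ContainsC P e copies)))

lemma3p2 : (k : ℕ) → 3 ≤ k → (n : ℕ) (D : Digraph n) (v : Fin n) →
    ¬ ContainsForbidden k (arc D) → ¬ ContainsForbidden k (arc (clone D v))
lemma3p2 k _ n D v D-free (inj₁ (m , 2≤ , m<k , e)) =
  D-free (inj₁ (m , 2≤ , m<k ,
    Contains-unclone D v (around-hamiltonian zero) (<⇒≤ m<k) (D-free ∘ inj₁) e))
lemma3p2 k _ n D v D-free (inj₂ (m , 3≤ , m<k , d , blocks@(_ , _ , _ , changes) , e)) =
  D-free (inj₂ (m , 3≤ , m<k , d , blocks ,
    Contains-unclone D v (orientation-hamiltonian changes) (<⇒≤ m<k) (D-free ∘ inj₁) e))
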